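{- Let $0<|q|<1$ and $a,b,u,v,w\in\mathbb{C}$. Then $$\mathrm{T}(yD_{q}|u)\{\mathrm{e}_{q}(ax,v)\mathrm{e}_{q}(bx,w)\}=\sum_{k=0}^{\infty}\sum_{n=0}^{\infty}(uv)^{\binom{k}{2}}(uw)^{\binom{n}{2}}\frac{(ay)^{k}}{(q;q)_{k}}\frac{(u^{k}by)^{n}}{(q;q)_{n}}\,\mathrm{e}_{q}(av^{k}x,v)\,\mathrm{e}_{q}(bq^{k}w^{n}x,w).$$
   Context: $(a;q)_n=\prod_{k=0}^{n-1}(1-aq^k)$. The deformed $q$-exponential is $\mathrm{e}_{q}(z,u)=\sum_{n=0}^{\infty}u^{\binom{n}{2}}\frac{z^{n}}{(q;q)_{n}}$ (with $0^0=1$). The $q$-differential operator in $x$ is $D_qf(x)=\frac{f(x)-f(qx)}{x}$ (so $D_qx^k=(1-q^k)x^{k-1}$), and $\mathrm{T}(yD_{q}|u)=\sum_{n=0}^{\infty}u^{\binom{n}{2}}\frac{y^{n}D_{q}^{n}}{(q;q)_{n}}$ acts on power series in $x$. The identity is understood as an identity of formal power series in $x$ and $y$. -}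

module Defs where

open import Level using (Level)
open import Data.Nat using (ℕ; zero; suc; _∸_) renaming (_+_ to _+ℕ_)
open import Data.Nat.Combinatorics using (_C_)
open import Algebra.Bundles using (CommutativeRing)

-- A formal power series in x is a coefficient function ℕ → Carrier
-- (index m = coefficient of x^m); a formal power series in x and y is
-- ℕ → ℕ → Carrier (f m n = coefficient of x^m y^n).
module QSeries {c ℓ : Level} (R : CommutativeRing c ℓ) where
  open CommutativeRing R
  open import Algebra.Properties.Semiring.Exp semiring public using (_^_)

  Series₁ : Set c
  Series₁ = ℕ → Carrier

  Series₂ : Set c
  Series₂ = ℕ → ℕ → Carrier

  sumTo : ℕ → (ℕ → Carrier) → Carrier
  sumTo zero    f = 0#
  sumTo (suc n) f = sumTo n f + f n

  prodTo : ℕ → (ℕ → Carrier) → Carrier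
  prodTo zero    f = 1#
  prodTo (suc n) f = prodTo n f * f n

  poch : Carrier → Carrier → ℕ → Carrier
  poch a q n = prodTo n (λ k → 1# - a * (q ^ k))

  b2 : ℕ → ℕ
  b2 n = n C 2

  -- Parameters: q and a family of inverses of (q;q)_n (division by (q;q)_n).
  module WithQ (q : Carrier) (inv : ℕ → Carrier) where

    -- e_q(z x, v) as a power series in x:  Σ_n v^{C(n,2)} z^n x^n / (q;q)_n
    eq : Carrier → Carrier → Series₁
    eq z v n = (v ^ b2 n) * (z ^ n) * inv n

    mul : Series₁ → Series₁ → Series₁
    mul f g m = sumTo (suc m) (λ i → f i * g (m ∸ i))

    -- D_q f(x) = (f(x) - f(qx))/x, i.e. D_q x^k = (1 - q^k) x^{k-1}
    Dq : Series₁ → Series₁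
    Dq f m = (1# - q ^ suc m) * f (suc m)

    Dqⁿ : ℕ → Series₁ → Series₁
    Dqⁿ zero    f = f
    Dqⁿ (suc n) f = Dq (Dqⁿ n f)

    -- T(y D_q | u) f = Σ_n u^{C(n,2)} y^n D_q^n f / (q;q)_n, as a series in x,y
    T : Carrier → Series₁ → Series₂
    T u f m n = (u ^ b2 n) * inv n * Dqⁿ n f m

    -- Σ_{k≥0} Σ_{n≥0} y^{k+n} F k n  (F k n a series in x), as a series in x,y
    dsum : (ℕ → ℕ → Series₁) → Series₂
    dsum F m N = sumTo (suc N) (λ k → F k (N ∸ k) m)

{-# OPTIONS --safe #-}
module Submission where

-- The q-Leibniz rule  D_q^N (f g)(x) = Σ_{k+n=N} [k+n, k]_q (D_q^k f)(x) (D_q^n g)(q^k x)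
-- follows by induction on N from the one-step rule
-- D_q (f g)(x) = (D_q f)(x) g(q x) + f(x) (D_q g)(x), the q-binomials entering through
-- their Pascal recursion.  For f = e_q(a x, v) and g = e_q(b x, w) every derivative is
-- again a deformed exponential, D_q^k e_q(z x, v) = z^k v^C(k,2) e_q(z v^k x, v), so the
-- (k, n) term of T(y D_q | u) is a product of two such series.  Its scalar factor is
-- rewritten with [k+n, k]_q / (q;q)_{k+n} = 1 / ((q;q)_k (q;q)_n) and
-- C(k+n, 2) = C(k, 2) + C(n, 2) + k n.  Everything is an identity between coefficients,
-- valid in any commutative ring where the (q;q)_n are invertible.

open import Defs
open import Level using (Level)
open import Data.Nat using (ℕ)
open import Relation.Nullary using (¬_)
open import Algebra.Bundles using (CommutativeRing)

open import Data.Nat using (zero; suc; _∸_; s≤s) renaming (_+_ to _+ℕ_; _*_ to _*ℕ_; _<_ to _<ℕ_)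
import Data.Nat.Properties as ℕ
open import Data.Nat.Combinatorics using (_C_; nCk+nC[k+1]≡[n+1]C[k+1]; nC1≡n)
open import Data.Nat.Solver using (module +-*-Solver)
import Relation.Binary.PropositionalEquality as ≡
open ≡ using (_≡_)
import Relation.Binary.Reasoning.Setoid as SetoidReasoning
import Algebra.Properties.CommutativeSemigroup as CommutativeSemigroupProperties
import Algebra.Properties.Ring as RingProperties
import Algebra.Properties.Semiring.Exp as SemiringExp
import Algebra.Properties.CommutativeSemiring.Exp as CommutativeSemiringExp
import Algebra.Solver.Ring.NaturalCoefficients.Default as RingSolver

[1+n]C2≡n+nC2 : ∀ n → suc n C 2 ≡ n +ℕ n C 2
[1+n]C2≡n+nC2 n = ≡.trans (≡.sym (nCk+nC[k+1]≡[n+1]C[k+1] n 1)) (≡.cong (_+ℕ n C 2) (nC1≡n n))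

[m+n]C2≡mC2+nC2+m*n : ∀ m n → (m +ℕ n) C 2 ≡ m C 2 +ℕ n C 2 +ℕ m *ℕ n
[m+n]C2≡mC2+nC2+m*n zero    n = ≡.sym (ℕ.+-identityʳ (n C 2))
[m+n]C2≡mC2+nC2+m*n (suc m) n = begin
  suc (m +ℕ n) C 2                      ≡⟨ [1+n]C2≡n+nC2 (m +ℕ n) ⟩
  m +ℕ n +ℕ (m +ℕ n) C 2                ≡⟨ ≡.cong (m +ℕ n +ℕ_) ([m+n]C2≡mC2+nC2+m*n m n) ⟩
  m +ℕ n +ℕ (m C 2 +ℕ n C 2 +ℕ m *ℕ n)  ≡⟨ rearrange m n (m C 2) (n C 2) ⟩
  m +ℕ m C 2 +ℕ n C 2 +ℕ (n +ℕ m *ℕ n)  ≡⟨ ≡.cong (λ x → x +ℕ n C 2 +ℕ (n +ℕ m *ℕ n)) ([1+n]C2≡n+nC2 m) ⟨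
  suc m C 2 +ℕ n C 2 +ℕ suc m *ℕ n      ∎
  where
  open ≡.≡-Reasoning
  open +-*-Solver
  rearrange : ∀ m n x y → m +ℕ n +ℕ (x +ℕ y +ℕ m *ℕ n) ≡ m +ℕ x +ℕ y +ℕ (n +ℕ m *ℕ n)
  rearrange = solve 4 (λ m n x y → m :+ n :+ (x :+ y :+ m :* n) := m :+ x :+ y :+ (n :+ m :* n)) ≡.refl

module QSeriesProperties {c ℓ : Level} (R : CommutativeRing c ℓ) where
  open CommutativeRing R
  open QSeries R
  open RingProperties ring using (-‿distribˡ-*)
  open SemiringExp semiring using (^-congˡ; ^-congʳ; ^-homo-*; ^-assocʳ)
  open CommutativeSemiringExp commutativeSemiring using (^-distrib-*)
  open CommutativeSemigroupProperties *-commutativeSemigroup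
    using (x∙yz≈y∙xz; x∙yz≈xy∙z; x∙yz≈yx∙z; xy∙z≈xz∙y) renaming (interchange to *-interchange)
  open CommutativeSemigroupProperties +-commutativeSemigroup using () renaming (interchange to +-interchange)
  open SetoidReasoning setoid
  open RingSolver commutativeSemiring using (solve; _:=_; _:+_; _:*_; con)

  ≡⇒≈ : ∀ {x y} → x ≡ y → x ≈ y
  ≡⇒≈ ≡.refl = refl

  1^n≈1 : ∀ n → 1# ^ n ≈ 1#
  1^n≈1 zero    = refl
  1^n≈1 (suc n) = trans (*-identityˡ _) (1^n≈1 n)

  1-xy≈[1-x]y+[1-y] : ∀ x y → 1# - x * y ≈ (1# - x) * y + (1# - y)
  1-xy≈[1-x]y+[1-y] x y = begin
    1# + - (x * y)               ≈⟨ +-congˡ (-‿distribˡ-* x y) ⟩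
    1# + - x * y                 ≈⟨ +-identityʳ _ ⟨
    1# + - x * y + 0#            ≈⟨ +-congˡ (-‿inverseʳ y) ⟨
    1# + - x * y + (y + - y)     ≈⟨ rearrange (- x) y (- y) ⟩
    (1# + - x) * y + (1# + - y)  ∎
    where
    rearrange : ∀ x′ y y′ → 1# + x′ * y + (y + y′) ≈ (1# + x′) * y + (1# + y′)
    rearrange = solve 3 (λ x′ y y′ → con 1 :+ x′ :* y :+ (y :+ y′) := (con 1 :+ x′) :* y :+ (con 1 :+ y′)) refl

  ^-b2-suc : ∀ x n → x ^ b2 (suc n) ≈ x ^ n * x ^ b2 n
  ^-b2-suc x n = trans (^-congʳ x ([1+n]C2≡n+nC2 n)) (^-homo-* x n (b2 n))

  ^-b2-+ : ∀ x m n → x ^ b2 (m +ℕ n) ≈ x ^ b2 m * x ^ b2 n * (x ^ m) ^ n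
  ^-b2-+ x m n = begin
    x ^ b2 (m +ℕ n)                          ≈⟨ ^-congʳ x ([m+n]C2≡mC2+nC2+m*n m n) ⟩
    x ^ (b2 m +ℕ b2 n +ℕ m *ℕ n)             ≈⟨ ^-homo-* x (b2 m +ℕ b2 n) (m *ℕ n) ⟩
    x ^ (b2 m +ℕ b2 n) * x ^ (m *ℕ n)        ≈⟨ *-cong (^-homo-* x (b2 m) (b2 n)) (sym (^-assocʳ x m n)) ⟩
    x ^ b2 m * x ^ b2 n * (x ^ m) ^ n        ∎

  x*[p*x]⁻¹≈p⁻¹ : ∀ {p i x j} → i * p ≈ 1# → j * (p * x) ≈ 1# → x * j ≈ i
  x*[p*x]⁻¹≈p⁻¹ {p} {i} {x} {j} ip≈1 jpx≈1 = begin
    x * j                ≈⟨ *-identityˡ _ ⟨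
    1# * (x * j)         ≈⟨ *-congʳ ip≈1 ⟨
    i * p * (x * j)      ≈⟨ rearrange i p x j ⟩
    i * (j * (p * x))    ≈⟨ *-congˡ jpx≈1 ⟩
    i * 1#               ≈⟨ *-identityʳ i ⟩
    i                    ∎
    where
    rearrange : ∀ i p x j → i * p * (x * j) ≈ i * (j * (p * x))
    rearrange = solve 4 (λ i p x j → i :* p :* (x :* j) := i :* (j :* (p :* x))) refl

  [i*j]*[p*r]≈1 : ∀ {i p j r} → i * p ≈ 1# → j * r ≈ 1# → i * j * (p * r) ≈ 1#
  [i*j]*[p*r]≈1 ip≈1 jr≈1 = trans (*-interchange _ _ _ _) (trans (*-cong ip≈1 jr≈1) (*-identityˡ 1#))

  sumTo-cong : ∀ n {f g : ℕ → Carrier} → (∀ i → i <ℕ n → f i ≈ g i) → sumTo n f ≈ sumTo n g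
  sumTo-cong zero    f≈g = refl
  sumTo-cong (suc n) f≈g = +-cong (sumTo-cong n (λ i i<n → f≈g i (ℕ.m<n⇒m<1+n i<n))) (f≈g n (ℕ.n<1+n n))

  sumTo-distrib-+ : ∀ n (f g : ℕ → Carrier) → sumTo n (λ i → f i + g i) ≈ sumTo n f + sumTo n g
  sumTo-distrib-+ zero    f g = sym (+-identityʳ 0#)
  sumTo-distrib-+ (suc n) f g = trans (+-congʳ (sumTo-distrib-+ n f g)) (+-interchange _ _ _ _)

  *-distribˡ-sumTo : ∀ x n (f : ℕ → Carrier) → x * sumTo n f ≈ sumTo n (λ i → x * f i)
  *-distribˡ-sumTo x zero    f = zeroʳ x
  *-distribˡ-sumTo x (suc n) f = trans (distribˡ x _ _) (+-congʳ (*-distribˡ-sumTo x n f))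

  sumTo-suc : ∀ n (f : ℕ → Carrier) → sumTo (suc n) f ≈ f 0 + sumTo n (λ i → f (suc i))
  sumTo-suc zero    f = +-comm 0# (f 0)
  sumTo-suc (suc n) f = trans (+-congʳ (sumTo-suc n f)) (+-assoc _ _ _)

  -- Σ_{k+n=N} h k n; mul and dsum unfold definitionally to such sums.
  antidiagonal : ℕ → (ℕ → ℕ → Carrier) → Carrier
  antidiagonal N h = sumTo (suc N) (λ k → h k (N ∸ k))

  antidiagonal-cong : ∀ N {h h′ : ℕ → ℕ → Carrier} →
                      (∀ k n → k +ℕ n ≡ N → h k n ≈ h′ k n) → antidiagonal N h ≈ antidiagonal N h′
  antidiagonal-cong N h≈h′ = sumTo-cong (suc N) (λ { k (s≤s k≤N) → h≈h′ k (N ∸ k) (ℕ.m+[n∸m]≡n k≤N) })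

  antidiagonal-distrib-+ : ∀ N (h h′ : ℕ → ℕ → Carrier) →
                           antidiagonal N (λ k n → h k n + h′ k n) ≈ antidiagonal N h + antidiagonal N h′
  antidiagonal-distrib-+ N h h′ = sumTo-distrib-+ (suc N) _ _

  *-distribˡ-antidiagonal : ∀ x N (h : ℕ → ℕ → Carrier) →
                            x * antidiagonal N h ≈ antidiagonal N (λ k n → x * h k n)
  *-distribˡ-antidiagonal x N h = *-distribˡ-sumTo x (suc N) _

  antidiagonal-sucˡ : ∀ N (h : ℕ → ℕ → Carrier) →
                      antidiagonal (suc N) h ≈ h 0 (suc N) + antidiagonal N (λ k n → h (suc k) n)
  antidiagonal-sucˡ N h = sumTo-suc (suc N) _

  antidiagonal-sucʳ : ∀ N (h : ℕ → ℕ → Carrier) →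
                      antidiagonal (suc N) h ≈ antidiagonal N (λ k n → h k (suc n)) + h (suc N) 0
  antidiagonal-sucʳ N h =
    +-cong (sumTo-cong (suc N) (λ { k (s≤s k≤N) → ≡⇒≈ (≡.cong (h k) (ℕ.+-∸-assoc 1 k≤N)) }))
           (≡⇒≈ (≡.cong (h (suc N)) (ℕ.n∸n≡0 N)))

  module WithQProperties (q : Carrier) (inv : ℕ → Carrier) where
    open WithQ q inv

    infix 4 _≋_
    _≋_ : Series₁ → Series₁ → Set ℓ
    f ≋ g = ∀ j → f j ≈ g j

    scale : Carrier → Series₁ → Series₁
    scale s f j = s * f j

    -- f(x) ↦ f(c x)
    dilate : Carrier → Series₁ → Series₁
    dilate c f j = c ^ j * f j

    Dq-cong : ∀ {f g} → f ≋ g → Dq f ≋ Dq g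
    Dq-cong f≋g j = *-congˡ (f≋g (suc j))

    mul-cong : ∀ {f f′ g g′} → f ≋ f′ → g ≋ g′ → mul f g ≋ mul f′ g′
    mul-cong f≋f′ g≋g′ m = antidiagonal-cong m (λ i j _ → *-cong (f≋f′ i) (g≋g′ j))

    Dq-scale : ∀ s f → Dq (scale s f) ≋ scale s (Dq f)
    Dq-scale s f j = x∙yz≈y∙xz _ s _

    Dq-dilate : ∀ c f → Dq (dilate c f) ≋ scale c (dilate c (Dq f))
    Dq-dilate c f j = begin
      (1# - q ^ suc j) * (c * c ^ j * f (suc j))    ≈⟨ x∙yz≈y∙xz _ _ _ ⟩
      c * c ^ j * ((1# - q ^ suc j) * f (suc j))    ≈⟨ *-assoc _ _ _ ⟩
      c * (c ^ j * ((1# - q ^ suc j) * f (suc j)))  ∎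

    dilate-dilate : ∀ c d f → dilate c (dilate d f) ≋ dilate (c * d) f
    dilate-dilate c d f j = trans (x∙yz≈xy∙z _ _ _) (*-congʳ (sym (^-distrib-* c d j)))

    dilate-1 : ∀ f → dilate 1# f ≋ f
    dilate-1 f j = trans (*-congʳ (1^n≈1 j)) (*-identityˡ _)

    dilate-scale : ∀ c s f → dilate c (scale s f) ≋ scale s (dilate c f)
    dilate-scale c s f j = x∙yz≈y∙xz _ s _

    mul-scaleˡ : ∀ s f g → mul (scale s f) g ≋ scale s (mul f g)
    mul-scaleˡ s f g m = trans (antidiagonal-cong m (λ i j _ → *-assoc s (f i) (g j)))
                               (sym (*-distribˡ-antidiagonal s m (λ i j → f i * g j)))

    mul-scaleʳ : ∀ s f g → mul f (scale s g) ≋ scale s (mul f g)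
    mul-scaleʳ s f g m = trans (antidiagonal-cong m (λ i j _ → x∙yz≈y∙xz (f i) s (g j)))
                               (sym (*-distribˡ-antidiagonal s m (λ i j → f i * g j)))

    1-q^0≈0 : 1# - q ^ 0 ≈ 0#
    1-q^0≈0 = -‿inverseʳ 1#

    -- Split 1 - q^(i+j) = (1 - q^i) q^j + (1 - q^j); the first part vanishes at i = 0 and
    -- the second at j = 0, which shifts the two halves of the sum onto D_q f and D_q g.
    Dq-mul : ∀ f g m → Dq (mul f g) m ≈ mul (Dq f) (dilate q g) m + mul f (Dq g) m
    Dq-mul f g m = begin
      (1# - q ^ suc m) * antidiagonal (suc m) h
        ≈⟨ *-distribˡ-antidiagonal _ (suc m) h ⟩
      antidiagonal (suc m) (λ i j → (1# - q ^ suc m) * h i j)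
        ≈⟨ antidiagonal-cong (suc m) split ⟩
      antidiagonal (suc m) (λ i j → h₁ i j + h₂ i j)
        ≈⟨ antidiagonal-distrib-+ (suc m) h₁ h₂ ⟩
      antidiagonal (suc m) h₁ + antidiagonal (suc m) h₂
        ≈⟨ +-cong (antidiagonal-sucˡ m h₁) (antidiagonal-sucʳ m h₂) ⟩
      (h₁ 0 (suc m) + antidiagonal m (λ i j → h₁ (suc i) j))
        + (antidiagonal m (λ i j → h₂ i (suc j)) + h₂ (suc m) 0)
        ≈⟨ +-cong (+-congʳ h₁-boundary) (+-congˡ h₂-boundary) ⟩
      (0# + antidiagonal m (λ i j → h₁ (suc i) j)) + (antidiagonal m (λ i j → h₂ i (suc j)) + 0#)
        ≈⟨ +-cong (+-identityˡ _) (+-identityʳ _) ⟩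
      antidiagonal m (λ i j → h₁ (suc i) j) + antidiagonal m (λ i j → h₂ i (suc j))
        ≈⟨ +-cong (antidiagonal-cong m (λ i j _ → *-interchange (1# - q ^ suc i) (q ^ j) (f (suc i)) (g j)))
                 (antidiagonal-cong m (λ i j _ → x∙yz≈y∙xz (1# - q ^ suc j) (f i) (g (suc j)))) ⟩
      mul (Dq f) (dilate q g) m + mul f (Dq g) m
        ∎
      where
      h h₁ h₂ : ℕ → ℕ → Carrier
      h  i j = f i * g j
      h₁ i j = (1# - q ^ i) * q ^ j * h i j
      h₂ i j = (1# - q ^ j) * h i j

      split : ∀ i j → i +ℕ j ≡ suc m → (1# - q ^ suc m) * h i j ≈ h₁ i j + h₂ i j
      split i j i+j≡1+m = begin
        (1# - q ^ suc m) * h i j                       ≈⟨ *-congʳ (+-congˡ (-‿cong (^-congʳ q (≡.sym i+j≡1+m)))) ⟩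
        (1# - q ^ (i +ℕ j)) * h i j                    ≈⟨ *-congʳ (+-congˡ (-‿cong (^-homo-* q i j))) ⟩
        (1# - q ^ i * q ^ j) * h i j                   ≈⟨ *-congʳ (1-xy≈[1-x]y+[1-y] (q ^ i) (q ^ j)) ⟩
        ((1# - q ^ i) * q ^ j + (1# - q ^ j)) * h i j  ≈⟨ distribʳ _ _ _ ⟩
        h₁ i j + h₂ i j                                ∎

      h₁-boundary : h₁ 0 (suc m) ≈ 0#
      h₁-boundary = trans (*-congʳ (trans (*-congʳ 1-q^0≈0) (zeroˡ _))) (zeroˡ _)

      h₂-boundary : h₂ (suc m) 0 ≈ 0#
      h₂-boundary = trans (*-congʳ 1-q^0≈0) (zeroˡ _)

    -- qbin k n is the Gaussian binomial coefficient [k+n, k]_q.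
    qbin : ℕ → ℕ → Carrier
    qbin zero    n       = 1#
    qbin (suc k) zero    = 1#
    qbin (suc k) (suc n) = qbin k (suc n) + q ^ suc k * qbin (suc k) n

    qbin-zeroʳ : ∀ k → qbin k 0 ≈ 1#
    qbin-zeroʳ zero    = refl
    qbin-zeroʳ (suc k) = refl

    qbin-poch : ∀ k n → poch q q k * poch q q n * qbin k n ≈ poch q q (k +ℕ n)
    qbin-poch zero    n       = trans (*-congʳ (*-identityˡ _)) (*-identityʳ _)
    qbin-poch (suc k) zero    =
      trans (*-identityʳ _) (trans (*-identityʳ _) (≡⇒≈ (≡.cong (poch q q) (≡.sym (ℕ.+-identityʳ (suc k))))))
    qbin-poch (suc k) (suc n) = begin
      pk * α * (pn * β) * (A + q ^ suc k * B)
        ≈⟨ rearrange pk α pn β A (q ^ suc k) B ⟩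
      α * (pk * (pn * β) * A) + q ^ suc k * β * (pk * α * pn * B)
        ≈⟨ +-cong (*-congˡ (qbin-poch k (suc n))) (*-congˡ (qbin-poch (suc k) n)) ⟩
      α * poch q q (k +ℕ suc n) + q ^ suc k * β * poch q q (suc k +ℕ n)
        ≈⟨ +-congˡ (*-congˡ (≡⇒≈ (≡.cong (poch q q) (≡.sym (ℕ.+-suc k n))))) ⟩
      α * P + q ^ suc k * β * P
        ≈⟨ factor α (q ^ suc k) β P ⟩
      P * (β * q ^ suc k + α)
        ≈⟨ *-congˡ (1-xy≈[1-x]y+[1-y] (q ^ suc n) (q ^ suc k)) ⟨
      P * (1# - q ^ suc n * q ^ suc k)
        ≈⟨ *-congˡ (+-congˡ (-‿cong (trans (*-comm _ _) (sym (^-homo-* q (suc k) (suc n)))))) ⟩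
      P * (1# - q ^ (suc k +ℕ suc n))
        ∎
      where
      pk = poch q q k
      pn = poch q q n
      α  = 1# - q ^ suc k
      β  = 1# - q ^ suc n
      A  = qbin k (suc n)
      B  = qbin (suc k) n
      P  = poch q q (k +ℕ suc n)
      rearrange : ∀ pk α pn β A Q B →
                  pk * α * (pn * β) * (A + Q * B) ≈ α * (pk * (pn * β) * A) + Q * β * (pk * α * pn * B)
      rearrange = solve 7 (λ pk α pn β A Q B →
        pk :* α :* (pn :* β) :* (A :+ Q :* B) := α :* (pk :* (pn :* β) :* A) :+ Q :* β :* (pk :* α :* pn :* B)) refl
      factor : ∀ α Q β P → α * P + Q * β * P ≈ P * (β * Q + α)
      factor = solve 4 (λ α Q β P → α :* P :+ Q :* β :* P := P :* (β :* Q :+ α)) refl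

    antidiagonal-qbin : ∀ N (X : ℕ → ℕ → Carrier) →
      antidiagonal (suc N) (λ k n → qbin k n * X k n)
        ≈ antidiagonal N (λ k n → qbin k n * X (suc k) n)
          + antidiagonal N (λ k n → q ^ k * qbin k n * X k (suc n))
    antidiagonal-qbin N X = begin
      antidiagonal (suc N) (λ k n → qbin k n * X k n)
        ≈⟨ antidiagonal-cong (suc N) split ⟩
      antidiagonal (suc N) (λ k n → left k n * X k n + right k n * X k n)
        ≈⟨ antidiagonal-distrib-+ (suc N) (λ k n → left k n * X k n) (λ k n → right k n * X k n) ⟩
      antidiagonal (suc N) (λ k n → left k n * X k n) + antidiagonal (suc N) (λ k n → right k n * X k n)
        ≈⟨ +-cong (antidiagonal-sucˡ N (λ k n → left k n * X k n))
                  (antidiagonal-sucʳ N (λ k n → right k n * X k n)) ⟩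
      (0# * X 0 (suc N) + antidiagonal N (λ k n → qbin k n * X (suc k) n))
        + (antidiagonal N (λ k n → q ^ k * qbin k n * X k (suc n)) + 0# * X (suc N) 0)
        ≈⟨ +-cong (trans (+-congʳ (zeroˡ _)) (+-identityˡ _)) (trans (+-congˡ (zeroˡ _)) (+-identityʳ _)) ⟩
      antidiagonal N (λ k n → qbin k n * X (suc k) n)
        + antidiagonal N (λ k n → q ^ k * qbin k n * X k (suc n))
        ∎
      where
      -- On k + n = N + 1 the Pascal recursion reads qbin k n = left k n + right k n,
      -- with left vanishing at k = 0 and right at n = 0.
      left right : ℕ → ℕ → Carrier
      left zero    n = 0#
      left (suc k) n = qbin k n
      right k zero    = 0#
      right k (suc n) = q ^ k * qbin k n

      qbin-split : ∀ k n → k +ℕ n ≡ suc N → qbin k n ≈ left k n + right k n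
      qbin-split zero    (suc n) _ = sym (trans (+-identityˡ _) (*-identityˡ _))
      qbin-split (suc k) zero    _ = sym (trans (+-identityʳ _) (qbin-zeroʳ k))
      qbin-split (suc k) (suc n) _ = refl

      split : ∀ k n → k +ℕ n ≡ suc N → qbin k n * X k n ≈ left k n * X k n + right k n * X k n
      split k n k+n≡1+N = trans (*-congʳ (qbin-split k n k+n≡1+N)) (distribʳ (X k n) (left k n) (right k n))

    q-Leibniz : ∀ f g N m →
      Dqⁿ N (mul f g) m ≈ antidiagonal N (λ k n → qbin k n * mul (Dqⁿ k f) (dilate (q ^ k) (Dqⁿ n g)) m)
    q-Leibniz f g zero m = sym (begin
      0# + 1# * mul f (dilate 1# g) m  ≈⟨ +-identityˡ _ ⟩
      1# * mul f (dilate 1# g) m       ≈⟨ *-identityˡ _ ⟩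
      mul f (dilate 1# g) m            ≈⟨ mul-cong (λ _ → refl) (dilate-1 g) m ⟩
      mul f g m                        ∎)
    q-Leibniz f g (suc N) m = begin
      (1# - q ^ suc m) * Dqⁿ N (mul f g) (suc m)
        ≈⟨ *-congˡ (q-Leibniz f g N (suc m)) ⟩
      (1# - q ^ suc m) * antidiagonal N (λ k n → qbin k n * X k n (suc m))
        ≈⟨ *-distribˡ-antidiagonal _ N (λ k n → qbin k n * X k n (suc m)) ⟩
      antidiagonal N (λ k n → (1# - q ^ suc m) * (qbin k n * X k n (suc m)))
        ≈⟨ antidiagonal-cong N (λ k n _ → step k n) ⟩
      antidiagonal N (λ k n → qbin k n * X (suc k) n m + q ^ k * qbin k n * X k (suc n) m)
        ≈⟨ antidiagonal-distrib-+ N (λ k n → qbin k n * X (suc k) n m) (λ k n → q ^ k * qbin k n * X k (suc n) m) ⟩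
      antidiagonal N (λ k n → qbin k n * X (suc k) n m)
        + antidiagonal N (λ k n → q ^ k * qbin k n * X k (suc n) m)
        ≈⟨ antidiagonal-qbin N (λ k n → X k n m) ⟨
      antidiagonal (suc N) (λ k n → qbin k n * X k n m)
        ∎
      where
      X : ℕ → ℕ → Series₁
      X k n = mul (Dqⁿ k f) (dilate (q ^ k) (Dqⁿ n g))

      step : ∀ k n → (1# - q ^ suc m) * (qbin k n * X k n (suc m))
                     ≈ qbin k n * X (suc k) n m + q ^ k * qbin k n * X k (suc n) m
      step k n = begin
        (1# - q ^ suc m) * (qbin k n * X k n (suc m))  ≈⟨ x∙yz≈y∙xz (1# - q ^ suc m) (qbin k n) (X k n (suc m)) ⟩
        qbin k n * Dq (X k n) m                        ≈⟨ *-congˡ (Dq-mul (Dqⁿ k f) (dilate (q ^ k) (Dqⁿ n g)) m) ⟩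
        qbin k n * (mul (Dqⁿ (suc k) f) (dilate q (dilate (q ^ k) (Dqⁿ n g))) m
                    + mul (Dqⁿ k f) (Dq (dilate (q ^ k) (Dqⁿ n g))) m)
          ≈⟨ *-congˡ (+-cong (mul-cong (λ _ → refl) (dilate-dilate q (q ^ k) (Dqⁿ n g)) m)
                             (trans (mul-cong (λ _ → refl) (Dq-dilate (q ^ k) (Dqⁿ n g)) m)
                                    (mul-scaleʳ (q ^ k) (Dqⁿ k f) (dilate (q ^ k) (Dqⁿ (suc n) g)) m))) ⟩
        qbin k n * (X (suc k) n m + q ^ k * X k (suc n) m)
          ≈⟨ distribˡ (qbin k n) (X (suc k) n m) (q ^ k * X k (suc n) m) ⟩
        qbin k n * X (suc k) n m + qbin k n * (q ^ k * X k (suc n) m)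
          ≈⟨ +-congˡ (x∙yz≈yx∙z (qbin k n) (q ^ k) (X k (suc n) m)) ⟩
        qbin k n * X (suc k) n m + q ^ k * qbin k n * X k (suc n) m
          ∎

    eq-cong : ∀ {z z′} v → z ≈ z′ → eq z v ≋ eq z′ v
    eq-cong v z≈z′ j = *-congʳ (*-congˡ (^-congˡ j z≈z′))

    dilate-eq : ∀ c z v → dilate c (eq z v) ≋ eq (z * c) v
    dilate-eq c z v j = begin
      c ^ j * (v ^ b2 j * z ^ j * inv j)  ≈⟨ rearrange (c ^ j) (v ^ b2 j) (z ^ j) (inv j) ⟩
      v ^ b2 j * (z ^ j * c ^ j) * inv j  ≈⟨ *-congʳ (*-congˡ (^-distrib-* z c j)) ⟨
      v ^ b2 j * (z * c) ^ j * inv j      ∎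
      where
      rearrange : ∀ C V Z I → C * (V * Z * I) ≈ V * (Z * C) * I
      rearrange = solve 4 (λ C V Z I → C :* (V :* Z :* I) := V :* (Z :* C) :* I) refl

    module _ (inv-poch : ∀ n → inv n * poch q q n ≈ 1#) where

      qbin*inv≈inv*inv : ∀ k n → qbin k n * inv (k +ℕ n) ≈ inv k * inv n
      qbin*inv≈inv*inv k n = x*[p*x]⁻¹≈p⁻¹ ([i*j]*[p*r]≈1 (inv-poch k) (inv-poch n))
                                           (trans (*-congˡ (qbin-poch k n)) (inv-poch (k +ℕ n)))

      Dq-eq : ∀ z v → Dq (eq z v) ≋ scale z (eq (z * v) v)
      Dq-eq z v j = begin
        γ * (v ^ b2 (suc j) * z ^ suc j * inv (suc j))
          ≈⟨ *-congˡ (*-congʳ (*-congʳ (^-b2-suc v j))) ⟩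
        γ * (v ^ j * v ^ b2 j * (z * z ^ j) * inv (suc j))
          ≈⟨ rearrange γ (v ^ j) (v ^ b2 j) z (z ^ j) (inv (suc j)) ⟩
        z * (v ^ b2 j * (z ^ j * v ^ j) * (γ * inv (suc j)))
          ≈⟨ *-congˡ (*-cong (*-congˡ (sym (^-distrib-* z v j))) (x*[p*x]⁻¹≈p⁻¹ (inv-poch j) (inv-poch (suc j)))) ⟩
        z * (v ^ b2 j * (z * v) ^ j * inv j)
          ∎
        where
        γ = 1# - q ^ suc j
        rearrange : ∀ γ Vj V z Zj I → γ * (Vj * V * (z * Zj) * I) ≈ z * (V * (Zj * Vj) * (γ * I))
        rearrange = solve 6 (λ γ Vj V z Zj I →
          γ :* (Vj :* V :* (z :* Zj) :* I) := z :* (V :* (Zj :* Vj) :* (γ :* I))) refl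

      Dqⁿ-eq : ∀ k z v → Dqⁿ k (eq z v) ≋ scale (z ^ k * v ^ b2 k) (eq (z * v ^ k) v)
      Dqⁿ-eq zero    z v j =
        sym (trans (*-congʳ (*-identityˡ 1#)) (trans (*-identityˡ _) (eq-cong v (*-identityʳ z) j)))
      Dqⁿ-eq (suc k) z v j = begin
        Dq (Dqⁿ k (eq z v)) j                  ≈⟨ Dq-cong (Dqⁿ-eq k z v) j ⟩
        Dq (scale s (eq z′ v)) j               ≈⟨ Dq-scale s (eq z′ v) j ⟩
        s * Dq (eq z′ v) j                     ≈⟨ *-congˡ (Dq-eq z′ v j) ⟩
        s * (z′ * eq (z′ * v) v j)             ≈⟨ *-assoc _ _ _ ⟨
        s * z′ * eq (z′ * v) v j               ≈⟨ *-cong s*z′≈ (eq-cong v (*-assoc z (v ^ k) v) j) ⟩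
        z ^ suc k * v ^ b2 (suc k) * eq (z * (v ^ k * v)) v j
                                               ≈⟨ *-congˡ (eq-cong v (*-congˡ (*-comm (v ^ k) v)) j) ⟩
        z ^ suc k * v ^ b2 (suc k) * eq (z * v ^ suc k) v j ∎
        where
        s  = z ^ k * v ^ b2 k
        z′ = z * v ^ k
        s*z′≈ : s * z′ ≈ z ^ suc k * v ^ b2 (suc k)
        s*z′≈ = trans (rearrange (z ^ k) (v ^ b2 k) z (v ^ k)) (*-congˡ (sym (^-b2-suc v k)))
          where
          rearrange : ∀ Z V z W → Z * V * (z * W) ≈ z * Z * (W * V)
          rearrange = solve 4 (λ Z V z W → Z :* V :* (z :* W) := z :* Z :* (W :* V)) refl

      dilate-Dqⁿ-eq : ∀ c n z v → dilate c (Dqⁿ n (eq z v)) ≋ scale (z ^ n * v ^ b2 n) (eq (z * c * v ^ n) v)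
      dilate-Dqⁿ-eq c n z v j = begin
        c ^ j * Dqⁿ n (eq z v) j          ≈⟨ *-congˡ (Dqⁿ-eq n z v j) ⟩
        c ^ j * (s * eq (z * v ^ n) v j)  ≈⟨ dilate-scale c s (eq (z * v ^ n) v) j ⟩
        s * (c ^ j * eq (z * v ^ n) v j)  ≈⟨ *-congˡ (dilate-eq c (z * v ^ n) v j) ⟩
        s * eq (z * v ^ n * c) v j        ≈⟨ *-congˡ (eq-cong v (xy∙z≈xz∙y z (v ^ n) c) j) ⟩
        s * eq (z * c * v ^ n) v j        ∎
        where s = z ^ n * v ^ b2 n

      mul-Dqⁿ-eq : ∀ k n a v b w →
        mul (Dqⁿ k (eq a v)) (dilate (q ^ k) (Dqⁿ n (eq b w)))
          ≋ scale (a ^ k * v ^ b2 k) (scale (b ^ n * w ^ b2 n) (mul (eq (a * v ^ k) v) (eq (b * q ^ k * w ^ n) w)))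
      mul-Dqⁿ-eq k n a v b w m =
        trans (mul-cong (Dqⁿ-eq k a v) (dilate-Dqⁿ-eq (q ^ k) n b w) m)
              (trans (mul-scaleˡ _ (eq (a * v ^ k) v) (scale (b ^ n * w ^ b2 n) (eq (b * q ^ k * w ^ n) w)) m)
                     (*-congˡ (mul-scaleʳ _ (eq (a * v ^ k) v) (eq (b * q ^ k * w ^ n) w) m)))

      T-mul-eq-summand : ∀ a b u v w m N k n → k +ℕ n ≡ N →
        u ^ b2 N * inv N * (qbin k n * mul (Dqⁿ k (eq a v)) (dilate (q ^ k) (Dqⁿ n (eq b w))) m)
          ≈ ((u * v) ^ b2 k) * ((u * w) ^ b2 n) * (((a ^ k) * inv k) * (((u ^ k) * b) ^ n * inv n))
            * mul (eq (a * (v ^ k)) v) (eq (b * (q ^ k) * (w ^ n)) w) m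
      T-mul-eq-summand a b u v w m _ k n ≡.refl = begin
        u ^ b2 (k +ℕ n) * inv (k +ℕ n) * (qbin k n * mul (Dqⁿ k (eq a v)) (dilate (q ^ k) (Dqⁿ n (eq b w))) m)
          ≈⟨ *-cong (*-congʳ (^-b2-+ u k n)) (*-congˡ (mul-Dqⁿ-eq k n a v b w m)) ⟩
        U₁ * U₂ * U₃ * inv (k +ℕ n) * (qbin k n * (aᵏ * V * (bⁿ * W * E)))
          ≈⟨ gather U₁ U₂ U₃ (inv (k +ℕ n)) (qbin k n) aᵏ V bⁿ W E ⟩
        qbin k n * inv (k +ℕ n) * (U₁ * U₂ * U₃ * aᵏ * V * bⁿ * W) * E
          ≈⟨ *-congʳ (*-congʳ (qbin*inv≈inv*inv k n)) ⟩
        inv k * inv n * (U₁ * U₂ * U₃ * aᵏ * V * bⁿ * W) * E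
          ≈⟨ *-congʳ (regroup (inv k) (inv n) U₁ U₂ U₃ aᵏ V bⁿ W) ⟩
        U₁ * V * (U₂ * W) * (aᵏ * inv k * (U₃ * bⁿ * inv n)) * E
          ≈⟨ *-congʳ (*-cong (*-cong (^-distrib-* u v (b2 k)) (^-distrib-* u w (b2 n)))
                             (*-congˡ (*-congʳ (^-distrib-* (u ^ k) b n)))) ⟨
        (u * v) ^ b2 k * (u * w) ^ b2 n * (aᵏ * inv k * ((u ^ k * b) ^ n * inv n)) * E
          ∎
        where
        U₁ = u ^ b2 k
        U₂ = u ^ b2 n
        U₃ = (u ^ k) ^ n
        aᵏ = a ^ k
        bⁿ = b ^ n
        V  = v ^ b2 k
        W  = w ^ b2 n
        E  = mul (eq (a * v ^ k) v) (eq (b * q ^ k * w ^ n) w) m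
        gather : ∀ U₁ U₂ U₃ I Q A V B W E →
                 U₁ * U₂ * U₃ * I * (Q * (A * V * (B * W * E))) ≈ Q * I * (U₁ * U₂ * U₃ * A * V * B * W) * E
        gather = solve 10 (λ U₁ U₂ U₃ I Q A V B W E →
          U₁ :* U₂ :* U₃ :* I :* (Q :* (A :* V :* (B :* W :* E)))
            := Q :* I :* (U₁ :* U₂ :* U₃ :* A :* V :* B :* W) :* E) refl
        regroup : ∀ Iₖ Iₙ U₁ U₂ U₃ A V B W →
                  Iₖ * Iₙ * (U₁ * U₂ * U₃ * A * V * B * W) ≈ U₁ * V * (U₂ * W) * (A * Iₖ * (U₃ * B * Iₙ))
        regroup = solve 9 (λ Iₖ Iₙ U₁ U₂ U₃ A V B W →
          Iₖ :* Iₙ :* (U₁ :* U₂ :* U₃ :* A :* V :* B :* W)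
            := U₁ :* V :* (U₂ :* W) :* (A :* Iₖ :* (U₃ :* B :* Iₙ))) refl

mainTheorem8 : {c ℓ : Level} (R : CommutativeRing c ℓ) →
  let open CommutativeRing R
      open QSeries R
  in (q : Carrier) → ¬ (q ≈ 0#) →
     (inv : ℕ → Carrier) → (∀ n → inv n * poch q q n ≈ 1#) →
     (a b u v w : Carrier) →
     let open WithQ q inv
     in ∀ (m N : ℕ) →
        T u (mul (eq a v) (eq b w)) m N
        ≈ dsum (λ k n x →
             ((u * v) ^ b2 k) * ((u * w) ^ b2 n)
             * (((a ^ k) * inv k) * (((u ^ k) * b) ^ n * inv n))
             * mul (eq (a * (v ^ k)) v) (eq (b * (q ^ k) * (w ^ n)) w) x) m N
mainTheorem8 R q _ inv inv-poch a b u v w m N = begin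
  u ^ b2 N * inv N * Dqⁿ N (mul (eq a v) (eq b w)) m
    ≈⟨ *-congˡ (q-Leibniz (eq a v) (eq b w) N m) ⟩
  u ^ b2 N * inv N * antidiagonal N (λ k n → qbin k n * Leibniz-term k n)
    ≈⟨ *-distribˡ-antidiagonal (u ^ b2 N * inv N) N (λ k n → qbin k n * Leibniz-term k n) ⟩
  antidiagonal N (λ k n → u ^ b2 N * inv N * (qbin k n * Leibniz-term k n))
    ≈⟨ antidiagonal-cong N (T-mul-eq-summand inv-poch a b u v w m N) ⟩
  antidiagonal N (λ k n → (u * v) ^ b2 k * (u * w) ^ b2 n * (a ^ k * inv k * ((u ^ k * b) ^ n * inv n))
                            * mul (eq (a * v ^ k) v) (eq (b * q ^ k * w ^ n) w) m)
    ∎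
  where
  open CommutativeRing R
  open QSeries R
  open WithQ q inv
  open QSeriesProperties R
  open WithQProperties q inv
  open SetoidReasoning setoid
  Leibniz-term : ℕ → ℕ → Carrier
  Leibniz-term k n = mul (Dqⁿ k (eq a v)) (dilate (q ^ k) (Dqⁿ n (eq b w))) m
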